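{- If $n\ge1$ and $k\ge2$, then $W(\mathcal{Q}_k^n)=n\binom{k}{2}k^{2(n-1)}$.
   Context: The $k$-uniform $n$-cube $\mathcal{Q}_k^n$ is the hypergraph with vertex set $\{0,1,\dots,k-1\}^n$ whose edges are exactly the sets consisting of all $n$-tuples that agree on a fixed set of $n-1$ coordinates (with fixed values) while the remaining coordinate ranges over $\{0,\dots,k-1\}$ (equivalently, the $n$-fold Cartesian product of the hypergraph with $k$ vertices and one edge containing all of them). In a hypergraph, a $u,v$-path of length $s\ge1$ is a sequence $u_0=u,e_1,u_1,\dots,e_s,u_s=v$ of pairwise distinct vertices and pairwise distinct edges with $\{u_{i-1},u_i\}\subseteq e_i$; $d(u,v)$ is the length of a shortest such path. The Wiener index $W$ is the sum of $d(u,v)$ over all unordered pairs of distinct vertices. -}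

module Defs where

open import Data.Nat using (ℕ; zero; suc; _≤_)
open import Data.Fin using (Fin; zero; suc)
open import Data.Vec using (Vec; []; _∷_; lookup)
open import Data.List using (List; []; _∷_; map; _++_; concatMap; allFin)
open import Data.Nat.ListAction using (sum)
open import Data.Product using (Σ; _×_; _,_; proj₁; proj₂)
open import Function.Bundles using (_⇔_)
open import Relation.Binary.PropositionalEquality using (_≡_; _≢_)
open import Relation.Nullary using (¬_)

-- A hypergraph: a vertex type, a type of edge labels, and incidence.
-- Edges are the SETS of vertices {v | v ∈ e}; two labels denote the same
-- edge iff they have the same vertex set.
record Hypergraph : Set₁ where
  field
    V   : Set
    E   : Set
    _∈_ : V → E → Set

module _ (H : Hypergraph) where
  open Hypergraph H

  SameEdge : E → E → Set
  SameEdge e f = ∀ v → (v ∈ e) ⇔ (v ∈ f)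

  -- a u,v-path of length s : u₀ = u, e₁, u₁, …, e_s, u_s = v
  -- (vertices indexed by Fin (suc s), edges e_{i+1} indexed by i : Fin s)
  record Path (u v : V) (s : ℕ) : Set where
    field
      vert      : Fin (suc s) → V
      edge      : Fin s → E
      start     : vert zero ≡ u
      end       : vert (Data.Fin.fromℕ s) ≡ v
      vertDist  : ∀ i j → vert i ≡ vert j → i ≡ j
      edgeDist  : ∀ i j → SameEdge (edge i) (edge j) → i ≡ j
      incidentL : ∀ (i : Fin s) → vert (Data.Fin.inject₁ i) ∈ edge i
      incidentR : ∀ (i : Fin s) → vert (suc i) ∈ edge i

  IsDistance : (V → V → ℕ) → Set
  IsDistance d = ∀ u v → u ≢ v →
    Path u v (d u v) × (∀ s → 1 ≤ s → Path u v s → d u v ≤ s)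

pairs : {A : Set} → List A → List (A × A)
pairs []       = []
pairs (x ∷ xs) = map (λ y → (x , y)) xs ++ pairs xs

-- Wiener index w.r.t. a distance function and a duplicate-free list of
-- all vertices: sum of d over unordered pairs of distinct vertices
wiener : {A : Set} → (A → A → ℕ) → List A → ℕ
wiener d vs = sum (map (λ p → d (proj₁ p) (proj₂ p)) (pairs vs))

allTuples : (k n : ℕ) → List (Vec (Fin k) n)
allTuples k zero    = [] ∷ []
allTuples k (suc n) = concatMap (λ a → map (a ∷_) (allTuples k n)) (allFin k)

-- the k-uniform n-cube Q_k^n: vertices {0..k-1}^n; an edge labelled (i , x)
-- is the set of tuples agreeing with x on every coordinate j ≠ i
-- (coordinate i free).
Qcube : (k n : ℕ) → Hypergraph
Qcube k n = record
  { V   = Vec (Fin k) n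
  ; E   = Fin n × Vec (Fin k) n
  ; _∈_ = λ v e → ∀ j → j ≢ proj₁ e → lookup v j ≡ lookup (proj₂ e) j
  }

module Submission where

open import Defs
open import Data.Nat using (ℕ; zero; suc; _+_; _*_; _∸_; _^_; _≤_; z≤n; s≤s)
open import Data.Nat.Properties
  using (≤-refl; +-mono-≤; +-assoc; +-identityʳ; *-identityʳ; *-zeroʳ; *-distribˡ-+; *-cancelˡ-≡; ^-distribˡ-+-*; module ≤-Reasoning)
open import Data.Nat.Combinatorics using (_C_; nCk+nC[k+1]≡[n+1]C[k+1]; nC1≡n)
open import Data.Nat.ListAction using (sum)
open import Data.Nat.Tactic.RingSolver using (solve-∀)
open import Data.Fin using (Fin; zero; suc; toℕ; fromℕ; inject₁; _≟_)
open import Data.Fin.Properties using (toℕ-fromℕ; suc-injective)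
open import Data.Vec using (Vec; []; _∷_; lookup)
open import Data.Vec.Properties using (∷-injectiveˡ; ∷-injectiveʳ; tabulate∘lookup; tabulate-cong)
open import Data.List using (List; []; _∷_; map; _++_; concatMap; allFin; length)
open import Data.List.Properties using (length-++; length-map; length-tabulate; map-tabulate)
open import Data.Product using (Σ; _×_; _,_; proj₁; proj₂)
open import Data.Empty using (⊥; ⊥-elim)
open import Relation.Nullary using (yes; no)
open import Relation.Binary.PropositionalEquality
  using (_≡_; _≢_; refl; sym; trans; cong; cong₂; subst; subst₂; module ≡-Reasoning)
open import Function.Bundles using (Equivalence)
import Function.Properties.Equivalence as ⇔

-- The distance in Q_k^n is the Hamming distance: an edge changes at most one
-- coordinate, and changing the differing coordinates one at a time gives a
-- path. Splitting off the first coordinate, the sum T(n) of Hamming distances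
-- over ordered pairs satisfies T(n+1) = k^n · k^n · k(k-1) + k² · T(n), hence
-- T(n) = n k(k-1) k^(2(n-1)), and the Wiener index is T(n)/2.

-- Hamming distance

δ : ∀ {k} → Fin k → Fin k → ℕ
δ zero    zero    = 0
δ zero    (suc _) = 1
δ (suc _) zero    = 1
δ (suc a) (suc b) = δ a b

δ-self : ∀ {k} (a : Fin k) → δ a a ≡ 0
δ-self zero    = refl
δ-self (suc a) = δ-self a

δ-≢ : ∀ {k} {a b : Fin k} → a ≢ b → δ a b ≡ 1
δ-≢ {a = zero}  {zero}  a≢b = ⊥-elim (a≢b refl)
δ-≢ {a = zero}  {suc b} a≢b = refl
δ-≢ {a = suc a} {zero}  a≢b = refl
δ-≢ {a = suc a} {suc b} a≢b = δ-≢ (λ a≡b → a≢b (cong suc a≡b))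

δ-sym : ∀ {k} (a b : Fin k) → δ a b ≡ δ b a
δ-sym zero    zero    = refl
δ-sym zero    (suc b) = refl
δ-sym (suc a) zero    = refl
δ-sym (suc a) (suc b) = δ-sym a b

δ≤1 : ∀ {k} (a b : Fin k) → δ a b ≤ 1
δ≤1 zero    zero    = z≤n
δ≤1 zero    (suc b) = ≤-refl
δ≤1 (suc a) zero    = ≤-refl
δ≤1 (suc a) (suc b) = δ≤1 a b

δ-triangle : ∀ {k} (a b c : Fin k) → δ a c ≤ δ a b + δ b c
δ-triangle a b c with a ≟ c
... | yes refl rewrite δ-self a = z≤n
... | no a≢c with a ≟ b
...   | yes refl rewrite δ-≢ a≢c | δ-self a = ≤-refl
...   | no a≢b   rewrite δ-≢ a≢c | δ-≢ a≢b  = s≤s z≤n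

ham : ∀ {k n} → Vec (Fin k) n → Vec (Fin k) n → ℕ
ham []      []      = 0
ham (a ∷ u) (b ∷ v) = δ a b + ham u v

ham-self : ∀ {k n} (u : Vec (Fin k) n) → ham u u ≡ 0
ham-self []      = refl
ham-self (a ∷ u) rewrite δ-self a = ham-self u

ham-sym : ∀ {k n} (u v : Vec (Fin k) n) → ham u v ≡ ham v u
ham-sym []      []      = refl
ham-sym (a ∷ u) (b ∷ v) = cong₂ _+_ (δ-sym a b) (ham-sym u v)

ham-triangle : ∀ {k n} (u v w : Vec (Fin k) n) → ham u w ≤ ham u v + ham v w
ham-triangle []      []      []      = z≤n
ham-triangle (a ∷ u) (b ∷ v) (c ∷ w) = begin
  δ a c + ham u w                           ≤⟨ +-mono-≤ (δ-triangle a b c) (ham-triangle u v w) ⟩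
  (δ a b + δ b c) + (ham u v + ham v w)     ≡⟨ interchange (δ a b) (δ b c) (ham u v) (ham v w) ⟩
  (δ a b + ham u v) + (δ b c + ham v w)     ∎
  where
  open ≤-Reasoning
  interchange : ∀ x y z t → (x + y) + (z + t) ≡ (x + z) + (y + t)
  interchange = solve-∀

lookup-ext : ∀ {A : Set} {n} (u v : Vec A n) → (∀ j → lookup u j ≡ lookup v j) → u ≡ v
lookup-ext u v eq = trans (sym (tabulate∘lookup u)) (trans (tabulate-cong eq) (tabulate∘lookup v))

ham≤1-if-agree-off : ∀ {k n} (i : Fin n) (u v : Vec (Fin k) n) →
  (∀ j → j ≢ i → lookup u j ≡ lookup v j) → ham u v ≤ 1
ham≤1-if-agree-off zero (a ∷ u) (b ∷ v) agree
  rewrite lookup-ext u v (λ j → agree (suc j) (λ ())) | ham-self v | +-identityʳ (δ a b) = δ≤1 a b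
ham≤1-if-agree-off (suc i) (a ∷ u) (b ∷ v) agree
  rewrite agree zero (λ ()) | δ-self b =
    ham≤1-if-agree-off i u v (λ j j≢i → agree (suc j) (λ e → j≢i (suc-injective e)))

ham-walk-≤ : ∀ {k n} (s : ℕ) (f : Fin (suc s) → Vec (Fin k) n) →
  (∀ (j : Fin s) → ham (f (inject₁ j)) (f (suc j)) ≤ 1) →
  ∀ i → ham (f zero) (f i) ≤ toℕ i
ham-walk-≤ s       f steps zero    rewrite ham-self (f zero) = z≤n
ham-walk-≤ (suc s) f steps (suc i) = begin
  ham (f zero) (f (suc i))                                   ≤⟨ ham-triangle (f zero) (f (suc zero)) (f (suc i)) ⟩
  ham (f zero) (f (suc zero)) + ham (f (suc zero)) (f (suc i))
    ≤⟨ +-mono-≤ (steps zero) (ham-walk-≤ s (λ x → f (suc x)) (λ j → steps (suc j)) i) ⟩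
  suc (toℕ i)                                                ∎
  where open ≤-Reasoning

-- Paths in Q_k^n

_∈Q_ : ∀ {k n} → Vec (Fin k) n → Fin n × Vec (Fin k) n → Set
_∈Q_ {k} {n} = Hypergraph._∈_ (Qcube k n)

consEdge : ∀ {k n} → Fin k → Fin n × Vec (Fin k) n → Fin (suc n) × Vec (Fin k) (suc n)
consEdge b (p , x) = (suc p , b ∷ x)

∈-consEdge⁺ : ∀ {k n} (b : Fin k) {v : Vec (Fin k) n} {e} → v ∈Q e → (b ∷ v) ∈Q consEdge b e
∈-consEdge⁺ b v∈e zero    _   = refl
∈-consEdge⁺ b v∈e (suc j) j≢i = v∈e j (λ j≡i → j≢i (cong suc j≡i))

∈-consEdge⁻ : ∀ {k n} {b c : Fin k} {v : Vec (Fin k) n} {e} → (b ∷ v) ∈Q consEdge c e → v ∈Q e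
∈-consEdge⁻ bv∈e j j≢i = bv∈e (suc j) (λ e → j≢i (suc-injective e))

SameEdge-consEdge⁻ : ∀ {k n} (b : Fin k) {e f : Fin n × Vec (Fin k) n} →
  SameEdge (Qcube k (suc n)) (consEdge b e) (consEdge b f) → SameEdge (Qcube k n) e f
SameEdge-consEdge⁻ b same v = record
  { to        = λ v∈e → ∈-consEdge⁻ (Equivalence.to   (same (b ∷ v)) (∈-consEdge⁺ b v∈e))
  ; from      = λ v∈f → ∈-consEdge⁻ (Equivalence.from (same (b ∷ v)) (∈-consEdge⁺ b v∈f))
  ; to-cong   = λ { refl → refl }
  ; from-cong = λ { refl → refl }
  }

module _ {k n : ℕ} where
  private
    Q  = Qcube k n
    Q⁺ = Qcube k (suc n)

  path-refl : (u : Vec (Fin k) n) → Path Q u u 0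
  path-refl u = record
    { vert = λ _ → u ; edge = λ () ; start = refl ; end = refl
    ; vertDist = λ { zero zero _ → refl }
    ; edgeDist = λ () ; incidentL = λ () ; incidentR = λ () }

  path-cons : ∀ {u v s} (b : Fin k) → Path Q u v s → Path Q⁺ (b ∷ u) (b ∷ v) s
  path-cons b P = record
    { vert      = λ i → b ∷ vert i
    ; edge      = λ i → consEdge b (edge i)
    ; start     = cong (b ∷_) start
    ; end       = cong (b ∷_) end
    ; vertDist  = λ i j e → vertDist i j (∷-injectiveʳ e)
    ; edgeDist  = λ i j same → edgeDist i j (SameEdge-consEdge⁻ b same)
    ; incidentL = λ i → ∈-consEdge⁺ b (incidentL i)
    ; incidentR = λ i → ∈-consEdge⁺ b (incidentR i)
    }
    where open Path P

  path-step : ∀ {u v s} {a b : Fin k} → a ≢ b → Path Q u v s → Path Q⁺ (a ∷ u) (b ∷ v) (suc s)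
  path-step {u} {v} {s} {a} {b} a≢b P = record
    { vert = vert⁺ ; edge = edge⁺ ; start = refl ; end = cong (b ∷_) end
    ; vertDist = vertDist⁺ ; edgeDist = edgeDist⁺ ; incidentL = incidentL⁺ ; incidentR = incidentR⁺ }
    where
    open Path P
    first : Fin (suc n) × Vec (Fin k) (suc n)
    first = (zero , a ∷ u)

    vert⁺ : Fin (suc (suc s)) → Vec (Fin k) (suc n)
    vert⁺ zero    = a ∷ u
    vert⁺ (suc i) = b ∷ vert i

    edge⁺ : Fin (suc s) → Fin (suc n) × Vec (Fin k) (suc n)
    edge⁺ zero    = first
    edge⁺ (suc i) = consEdge b (edge i)

    au∈first : (a ∷ u) ∈Q first
    au∈first j _ = refl

    bu∈first : (b ∷ u) ∈Q first
    bu∈first zero    j≢0 = ⊥-elim (j≢0 refl)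
    bu∈first (suc j) _   = refl

    first≠consEdge : ∀ e → SameEdge Q⁺ first (consEdge b e) → ⊥
    first≠consEdge e same = a≢b (trans (Equivalence.to (same (a ∷ u)) au∈first zero (λ ()))
                                       (sym (Equivalence.to (same (b ∷ u)) bu∈first zero (λ ()))))

    vertDist⁺ : ∀ i j → vert⁺ i ≡ vert⁺ j → i ≡ j
    vertDist⁺ zero    zero    _ = refl
    vertDist⁺ zero    (suc j) e = ⊥-elim (a≢b (∷-injectiveˡ e))
    vertDist⁺ (suc i) zero    e = ⊥-elim (a≢b (sym (∷-injectiveˡ e)))
    vertDist⁺ (suc i) (suc j) e = cong suc (vertDist i j (∷-injectiveʳ e))

    edgeDist⁺ : ∀ i j → SameEdge Q⁺ (edge⁺ i) (edge⁺ j) → i ≡ j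
    edgeDist⁺ zero    zero    _    = refl
    edgeDist⁺ zero    (suc j) same = ⊥-elim (first≠consEdge _ same)
    edgeDist⁺ (suc i) zero    same = ⊥-elim (first≠consEdge _ (λ w → ⇔.sym (same w)))
    edgeDist⁺ (suc i) (suc j) same = cong suc (edgeDist i j (SameEdge-consEdge⁻ b same))

    incidentL⁺ : ∀ i → vert⁺ (inject₁ i) ∈Q edge⁺ i
    incidentL⁺ zero    = au∈first
    incidentL⁺ (suc i) = ∈-consEdge⁺ b (incidentL i)

    incidentR⁺ : ∀ i → vert⁺ (suc i) ∈Q edge⁺ i
    incidentR⁺ zero    zero    j≢0 = ⊥-elim (j≢0 refl)
    incidentR⁺ zero    (suc j) _   = cong (λ w → lookup w j) start
    incidentR⁺ (suc i)             = ∈-consEdge⁺ b (incidentR i)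

ham-path : ∀ {k n} (u v : Vec (Fin k) n) → Path (Qcube k n) u v (ham u v)
ham-path []      []      = path-refl []
ham-path (a ∷ u) (b ∷ v) with a ≟ b
... | yes refl = subst (Path _ (a ∷ u) (a ∷ v)) (cong (_+ ham u v) (sym (δ-self a)))
                       (path-cons a (ham-path u v))
... | no a≢b   = subst (Path _ (a ∷ u) (b ∷ v)) (cong (_+ ham u v) (sym (δ-≢ a≢b)))
                       (path-step a≢b (ham-path u v))

ham≤path-length : ∀ {k n} {u v : Vec (Fin k) n} {s} → Path (Qcube k n) u v s → ham u v ≤ s
ham≤path-length {s = s} P =
  subst₂ (λ x y → ham x y ≤ s) start end
    (subst (ham (vert zero) (vert (fromℕ s)) ≤_) (toℕ-fromℕ s)
      (ham-walk-≤ s vert step≤1 (fromℕ s)))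
  where
  open Path P
  step≤1 : ∀ j → ham (vert (inject₁ j)) (vert (suc j)) ≤ 1
  step≤1 j = ham≤1-if-agree-off (proj₁ (edge j)) (vert (inject₁ j)) (vert (suc j))
               (λ i i≢ → trans (incidentL j i i≢) (sym (incidentR j i i≢)))

ham-isDistance : ∀ {k n} → IsDistance (Qcube k n) ham
ham-isDistance u v _ = ham-path u v , λ s _ P → ham≤path-length P

-- Sums over lists

infix 7 ∑
∑ : {A : Set} → List A → (A → ℕ) → ℕ
∑ xs f = sum (map f xs)
syntax ∑ xs (λ x → e) = ∑[ x ∈ xs ] e

private variable A B : Set

∑-cong : ∀ (xs : List A) {f g : A → ℕ} → (∀ x → f x ≡ g x) → ∑ xs f ≡ ∑ xs g
∑-cong []       eq = refl
∑-cong (x ∷ xs) eq = cong₂ _+_ (eq x) (∑-cong xs eq)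

∑-++ : ∀ (xs ys : List A) (f : A → ℕ) → ∑ (xs ++ ys) f ≡ ∑ xs f + ∑ ys f
∑-++ []       ys f = refl
∑-++ (x ∷ xs) ys f = trans (cong (f x +_) (∑-++ xs ys f)) (sym (+-assoc (f x) _ _))

∑-map : (g : A → B) (xs : List A) (f : B → ℕ) → ∑ (map g xs) f ≡ ∑[ x ∈ xs ] f (g x)
∑-map g []       f = refl
∑-map g (x ∷ xs) f = cong (f (g x) +_) (∑-map g xs f)

∑-concatMap : (g : A → List B) (xs : List A) (f : B → ℕ) →
  ∑ (concatMap g xs) f ≡ ∑[ x ∈ xs ] ∑ (g x) f
∑-concatMap g []       f = refl
∑-concatMap g (x ∷ xs) f = trans (∑-++ (g x) (concatMap g xs) f) (cong (∑ (g x) f +_) (∑-concatMap g xs f))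

∑-+ : ∀ (xs : List A) (f g : A → ℕ) → ∑[ x ∈ xs ] (f x + g x) ≡ ∑ xs f + ∑ xs g
∑-+ []       f g = refl
∑-+ (x ∷ xs) f g = trans (cong (f x + g x +_) (∑-+ xs f g)) (interchange (f x) (g x) _ _)
  where
  interchange : ∀ a b c d → (a + b) + (c + d) ≡ (a + c) + (b + d)
  interchange = solve-∀

∑-*ˡ : ∀ (c : ℕ) (xs : List A) (f : A → ℕ) → ∑[ x ∈ xs ] (c * f x) ≡ c * ∑ xs f
∑-*ˡ c []       f = sym (*-zeroʳ c)
∑-*ˡ c (x ∷ xs) f = trans (cong (c * f x +_) (∑-*ˡ c xs f)) (sym (*-distribˡ-+ c (f x) _))

∑-const : ∀ (xs : List A) (c : ℕ) → ∑[ x ∈ xs ] c ≡ length xs * c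
∑-const []       c = refl
∑-const (x ∷ xs) c = cong (c +_) (∑-const xs c)

length-concatMap : (g : A → List B) (xs : List A) →
  length (concatMap g xs) ≡ ∑[ x ∈ xs ] length (g x)
length-concatMap g []       = refl
length-concatMap g (x ∷ xs) = trans (length-++ (g x)) (cong (length (g x) +_) (length-concatMap g xs))

∑∑-separable : (xs : List A) (ys : List B) (f : A → ℕ) (g : B → ℕ) →
  ∑[ x ∈ xs ] ∑[ y ∈ ys ] (f x + g y) ≡ length ys * ∑ xs f + length xs * ∑ ys g
∑∑-separable xs ys f g = begin
  ∑[ x ∈ xs ] ∑[ y ∈ ys ] (f x + g y)     ≡⟨ ∑-cong xs (λ x → ∑-+ ys (λ _ → f x) g) ⟩
  ∑[ x ∈ xs ] (∑[ y ∈ ys ] f x + ∑ ys g)  ≡⟨ ∑-cong xs (λ x → cong (_+ ∑ ys g) (∑-const ys (f x))) ⟩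
  ∑[ x ∈ xs ] (length ys * f x + ∑ ys g)  ≡⟨ ∑-+ xs (λ x → length ys * f x) (λ _ → ∑ ys g) ⟩
  ∑[ x ∈ xs ] (length ys * f x) + ∑[ x ∈ xs ] ∑ ys g
                                          ≡⟨ cong₂ _+_ (∑-*ˡ (length ys) xs f) (∑-const xs (∑ ys g)) ⟩
  length ys * ∑ xs f + length xs * ∑ ys g ∎
  where open ≡-Reasoning

∑-pairs : ∀ {A : Set} (f : A → A → ℕ) → (∀ x → f x x ≡ 0) → (∀ x y → f x y ≡ f y x) → (xs : List A) →
  2 * (∑[ p ∈ pairs xs ] f (proj₁ p) (proj₂ p)) ≡ ∑[ x ∈ xs ] ∑[ y ∈ xs ] f x y
∑-pairs f diag symm []       = refl
∑-pairs {A} f diag symm (x ∷ xs) = begin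
  2 * ∑ (map (x ,_) xs ++ pairs xs) F                  ≡⟨ cong (2 *_) (∑-++ (map (x ,_) xs) (pairs xs) F) ⟩
  2 * (∑ (map (x ,_) xs) F + ∑ (pairs xs) F)           ≡⟨ cong (λ t → 2 * (t + ∑ (pairs xs) F)) (∑-map (x ,_) xs F) ⟩
  2 * (row + ∑ (pairs xs) F)                           ≡⟨ *-distribˡ-+ 2 row _ ⟩
  2 * row + 2 * ∑ (pairs xs) F                         ≡⟨ cong (2 * row +_) (∑-pairs f diag symm xs) ⟩
  2 * row + rest                                       ≡⟨ double row rest ⟩
  row + (row + rest)                                   ≡⟨ cong (λ t → row + (t + rest)) (∑-cong xs (symm x)) ⟩
  row + (∑[ z ∈ xs ] f z x + rest)                     ≡⟨ cong (row +_) (sym (∑-+ xs (λ z → f z x) (λ z → ∑ xs (f z)))) ⟩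
  row + columns                                        ≡⟨ cong (λ t → t + row + columns) (sym (diag x)) ⟩
  f x x + row + columns                                ∎
  where
  open ≡-Reasoning
  F : A × A → ℕ
  F p = f (proj₁ p) (proj₂ p)
  row rest columns : ℕ
  row     = ∑ xs (f x)
  rest    = ∑[ z ∈ xs ] ∑ xs (f z)
  columns = ∑[ z ∈ xs ] (f z x + ∑ xs (f z))
  double : ∀ a b → 2 * a + b ≡ a + (a + b)
  double = solve-∀

length-allFin : ∀ k → length (allFin k) ≡ k
length-allFin k = length-tabulate (λ i → i)

∑-allFin-suc : ∀ k (f : Fin (suc k) → ℕ) → ∑ (allFin (suc k)) f ≡ f zero + ∑[ i ∈ allFin k ] f (suc i)
∑-allFin-suc k f = cong (f zero +_)
  (trans (cong (λ xs → ∑ xs f) (sym (map-tabulate (λ i → i) suc))) (∑-map suc (allFin k) f))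

∑-allTuples-suc : ∀ k n (f : Vec (Fin k) (suc n) → ℕ) →
  ∑ (allTuples k (suc n)) f ≡ ∑[ a ∈ allFin k ] ∑[ u ∈ allTuples k n ] f (a ∷ u)
∑-allTuples-suc k n f =
  trans (∑-concatMap (λ a → map (a ∷_) (allTuples k n)) (allFin k) f)
        (∑-cong (allFin k) (λ a → ∑-map (a ∷_) (allTuples k n) f))

length-allTuples : ∀ k n → length (allTuples k n) ≡ k ^ n
length-allTuples k zero    = refl
length-allTuples k (suc n) = begin
  length (allTuples k (suc n))                      ≡⟨ length-concatMap (λ a → map (a ∷_) (allTuples k n)) (allFin k) ⟩
  ∑[ a ∈ allFin k ] length (map (a ∷_) (allTuples k n))
    ≡⟨ ∑-cong (allFin k) (λ a → trans (length-map (a ∷_) (allTuples k n)) (length-allTuples k n)) ⟩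
  ∑[ a ∈ allFin k ] k ^ n                           ≡⟨ ∑-const (allFin k) (k ^ n) ⟩
  length (allFin k) * k ^ n                         ≡⟨ cong (_* k ^ n) (length-allFin k) ⟩
  k * k ^ n                                         ∎
  where open ≡-Reasoning

-- The Wiener index of Q_k^n

∑-δ : ∀ {k} (a : Fin k) → ∑[ b ∈ allFin k ] δ a b ≡ k ∸ 1
∑-δ {suc k} zero = begin
  ∑ (allFin (suc k)) (δ zero)     ≡⟨ ∑-allFin-suc k (δ zero) ⟩
  ∑[ b ∈ allFin k ] 1             ≡⟨ ∑-const (allFin k) 1 ⟩
  length (allFin k) * 1           ≡⟨ *-identityʳ _ ⟩
  length (allFin k)               ≡⟨ length-allFin k ⟩
  k                               ∎
  where open ≡-Reasoning
∑-δ {suc (suc k)} (suc a) = trans (∑-allFin-suc (suc k) (δ (suc a))) (cong suc (∑-δ a))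

∑∑-δ : ∀ k → ∑[ a ∈ allFin k ] ∑[ b ∈ allFin k ] δ a b ≡ k * (k ∸ 1)
∑∑-δ k = begin
  ∑[ a ∈ allFin k ] ∑[ b ∈ allFin k ] δ a b  ≡⟨ ∑-cong (allFin k) ∑-δ ⟩
  ∑[ a ∈ allFin k ] (k ∸ 1)                  ≡⟨ ∑-const (allFin k) (k ∸ 1) ⟩
  length (allFin k) * (k ∸ 1)                ≡⟨ cong (_* (k ∸ 1)) (length-allFin k) ⟩
  k * (k ∸ 1)                                ∎
  where open ≡-Reasoning

totalHam : ∀ k n → ℕ
totalHam k n = ∑[ u ∈ allTuples k n ] ∑[ v ∈ allTuples k n ] ham u v

totalHam-suc : ∀ k n → totalHam k (suc n) ≡ k ^ n * (k ^ n * (k * (k ∸ 1))) + k * (k * totalHam k n)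
totalHam-suc k n = begin
  totalHam k (suc n)
    ≡⟨ ∑-allTuples-suc k n (λ w → ∑ (allTuples k (suc n)) (ham w)) ⟩
  ∑[ a ∈ F ] ∑[ u ∈ T ] ∑ (allTuples k (suc n)) (ham (a ∷ u))
    ≡⟨ ∑-cong F (λ a → ∑-cong T (λ u → ∑-allTuples-suc k n (ham (a ∷ u)))) ⟩
  ∑[ a ∈ F ] ∑[ u ∈ T ] ∑[ b ∈ F ] ∑[ v ∈ T ] (δ a b + ham u v)
    ≡⟨ ∑-cong F (λ a → ∑-cong T (λ u → ∑∑-separable F T (δ a) (ham u))) ⟩
  ∑[ a ∈ F ] ∑[ u ∈ T ] (length T * ∑ F (δ a) + length F * ∑ T (ham u))
    ≡⟨ ∑∑-separable F T (λ a → length T * ∑ F (δ a)) (λ u → length F * ∑ T (ham u)) ⟩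
  length T * (∑[ a ∈ F ] (length T * ∑ F (δ a))) + length F * (∑[ u ∈ T ] (length F * ∑ T (ham u)))
    ≡⟨ cong₂ _+_ (cong (length T *_) (∑-*ˡ (length T) F (λ a → ∑ F (δ a))))
                 (cong (length F *_) (∑-*ˡ (length F) T (λ u → ∑ T (ham u)))) ⟩
  length T * (length T * (∑[ a ∈ F ] ∑ F (δ a))) + length F * (length F * totalHam k n)
    ≡⟨ cong₂ (λ N K → N * (N * (∑[ a ∈ F ] ∑ F (δ a))) + K * (K * totalHam k n))
             (length-allTuples k n) (length-allFin k) ⟩
  k ^ n * (k ^ n * (∑[ a ∈ F ] ∑ F (δ a))) + k * (k * totalHam k n)
    ≡⟨ cong (λ D → k ^ n * (k ^ n * D) + k * (k * totalHam k n)) (∑∑-δ k) ⟩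
  k ^ n * (k ^ n * (k * (k ∸ 1))) + k * (k * totalHam k n)
    ∎
  where
  open ≡-Reasoning
  F : List (Fin k)
  F = allFin k
  T : List (Vec (Fin k) n)
  T = allTuples k n

totalHam-suc-closed : ∀ k n → totalHam k (suc n) ≡ suc n * (k * (k ∸ 1)) * (k ^ n * k ^ n)
totalHam-suc-closed k zero = trans (totalHam-suc k zero) (base (k * (k ∸ 1)) k)
  where
  base : ∀ c k → 1 * (1 * c) + k * (k * 0) ≡ 1 * c * (1 * 1)
  base = solve-∀
totalHam-suc-closed k (suc n) = begin
  totalHam k (suc (suc n))                               ≡⟨ totalHam-suc k (suc n) ⟩
  k * p * (k * p * c) + k * (k * totalHam k (suc n))     ≡⟨ cong (λ t → k * p * (k * p * c) + k * (k * t))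
                                                                  (totalHam-suc-closed k n) ⟩
  k * p * (k * p * c) + k * (k * (suc n * c * (p * p)))  ≡⟨ step c k p n ⟩
  suc (suc n) * c * (k * p * (k * p))                    ∎
  where
  open ≡-Reasoning
  c p : ℕ
  c = k * (k ∸ 1)
  p = k ^ n
  step : ∀ c k p n → k * p * (k * p * c) + k * (k * (suc n * c * (p * p))) ≡ suc (suc n) * c * (k * p * (k * p))
  step = solve-∀

2*nC2≡n*[n∸1] : ∀ n → 2 * (n C 2) ≡ n * (n ∸ 1)
2*nC2≡n*[n∸1] zero          = refl
2*nC2≡n*[n∸1] (suc zero)    = refl
2*nC2≡n*[n∸1] (suc (suc n)) = begin
  2 * (suc (suc n) C 2)           ≡⟨ cong (2 *_) (sym (nCk+nC[k+1]≡[n+1]C[k+1] (suc n) 1)) ⟩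
  2 * (suc n C 1 + suc n C 2)     ≡⟨ cong (λ t → 2 * (t + suc n C 2)) (nC1≡n (suc n)) ⟩
  2 * (suc n + suc n C 2)         ≡⟨ *-distribˡ-+ 2 (suc n) (suc n C 2) ⟩
  2 * suc n + 2 * (suc n C 2)     ≡⟨ cong (2 * suc n +_) (2*nC2≡n*[n∸1] (suc n)) ⟩
  2 * suc n + suc n * n           ≡⟨ arith n ⟩
  suc (suc n) * suc n             ∎
  where
  open ≡-Reasoning
  arith : ∀ n → 2 * suc n + suc n * n ≡ suc (suc n) * suc n
  arith = solve-∀

wiener-ham : ∀ k n → wiener ham (allTuples k n) ≡ n * (k C 2) * k ^ (2 * (n ∸ 1))
wiener-ham k zero    = refl
wiener-ham k (suc n) = *-cancelˡ-≡ _ _ 2 (begin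
  2 * wiener ham (allTuples k (suc n))     ≡⟨ ∑-pairs ham ham-self ham-sym (allTuples k (suc n)) ⟩
  totalHam k (suc n)                       ≡⟨ totalHam-suc-closed k n ⟩
  suc n * (k * (k ∸ 1)) * (k ^ n * k ^ n)  ≡⟨ cong₂ (λ c p → suc n * c * p) (sym (2*nC2≡n*[n∸1] k)) (sym k^[2n]) ⟩
  suc n * (2 * (k C 2)) * k ^ (2 * n)      ≡⟨ regroup (suc n) (k C 2) (k ^ (2 * n)) ⟩
  2 * (suc n * (k C 2) * k ^ (2 * n))      ∎)
  where
  open ≡-Reasoning
  k^[2n] : k ^ (2 * n) ≡ k ^ n * k ^ n
  k^[2n] = trans (cong (λ m → k ^ (n + m)) (+-identityʳ n)) (^-distribˡ-+-* k n n)
  regroup : ∀ m c q → m * (2 * c) * q ≡ 2 * (m * c * q)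
  regroup = solve-∀

proposition4p1 : (n k : ℕ) → 1 ≤ n → 2 ≤ k →
    Σ (Vec (Fin k) n → Vec (Fin k) n → ℕ) (λ d →
      IsDistance (Qcube k n) d ×
      wiener d (allTuples k n) ≡ n * (k C 2) * k ^ (2 * (n ∸ 1)))
proposition4p1 n k _ _ = ham , ham-isDistance , wiener-ham k n
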